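{- Let $(a_i)$ be a representing sequence with $a_1=k$, and let $w$ be its representation word; assume $w$ is strongly Fergusonian. Let $T=\{a_i-1\mid i\geq2\}\cup\{1,\dots,k-1\}$, let $N$ be the set of non-volatile zends with respect to $(a_i)$, and let $L=\mathbb{N}\setminus N$ (with $\mathbb N=\{0,1,2,\dots\}$). Let $I$ be a set of positive integers with $T\subseteq I$ and $(N+I)\cap N=\emptyset$. Then: (1) for every set $S$ with $T\subseteq S\subseteq I$, $w$ is the Nim sequence of $S$; (2) for every such $S$ and every $i$, writing $S_i=\{s\in S\mid s<a_i\}$: if $a+a_i-S_i\subseteq L$ for all $a\in N$ with $a<a_i$, then $\big(w[0..a_i)\big)^\omega$ is the Nim sequence of $S_i$.
   Context: A representing sequence is a strictly increasing sequence $(a_i)_{i\ge0}$ of positive integers with $a_0=1$. For $n\ge1$ with $a_j\le n<a_{j+1}$, the $(a_i)$-representation of $n$ is the digit string $d_j\cdots d_0$ with $n=\sum d_ia_i$ and $\sum d_i$ minimal (greedy); the representation of $0$ is the single digit $0$. $n$ is a zend if its representation ends in $0$. For a positive integer $m$, $n\ge0$ is $m$-volatile if the representation of $n+1$ ends in at least $m$ zeros; volatile means $1$-volatile; non-volatile means the representation of $n+1$ does not end in $0$. The representation word of $(a_i)$ is the word $w$ over $\{0,\dots,a_1\}$ with $w[n]=a_1$ if $n$ is $2$-volatile, and otherwise $w[n]$ is the last digit of the representation of $n$. A word over $\{0,1,\dots,k\}$ ($k\ge2$) is Fergusonian if for every $0\le i<k-1$ every occurrence of $i$ is immediately followed by $i+1$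 and every occurrence of $i+1$ is immediately preceded by $i$; it is strongly Fergusonian if moreover it has no two consecutive $k$'s. For sets $A,B$ and integer $n$: $A+B=\{a+b\}$, $n-A=\{n-a\}$, $A+n=\{a+n\}$, etc. Words are indexed from $0$; $w[a..b)$ is the factor from position $a$ to $b-1$; $u^\omega$ is the infinite repetition of $u$. For a set $S$ of positive integers, $\mathrm{SG}_S(n)=\mathrm{mex}\{\mathrm{SG}_S(n-s)\mid s\in S,s\le n\}$ and the Nim sequence of $S$ is $(\mathrm{SG}_S(n))_{n\ge0}$. -}

module Defs where

open import Data.Nat.Base
open import Data.Nat.Properties using (<-≤-trans)
open import Data.Bool.Base using (Bool; true; false; if_then_else_; _∧_)
open import Data.Product using (Σ; ∃; _×_; _,_)
open import Data.Sum using (_⊎_)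
open import Relation.Nullary using (¬_)
open import Relation.Binary.PropositionalEquality using (_≡_; _≢_; refl; subst; sym)

record RepSeq : Set where
  field
    seq   : ℕ → ℕ
    seq₀  : seq 0 ≡ 1
    incr  : ∀ i → seq i < seq (suc i)

open RepSeq public

pos : (A : RepSeq) → ∀ i → 0 < seq A i
pos A zero = subst (0 <_) (sym (seq₀ A)) (s≤s z≤n)
pos A (suc i) = <-≤-trans (pos A i) (<⇒≤ (incr A i))
  where
  <⇒≤ : ∀ {m n} → m < n → m ≤ n
  <⇒≤ (s≤s z≤n) = z≤n
  <⇒≤ (s≤s (s≤s p)) = s≤s (<⇒≤ (s≤s p))

nz : (A : RepSeq) → ∀ i → NonZero (seq A i)
nz A i = >-nonZero (pos A i)

down : RepSeq → ℕ → ℕ → ℕ → ℕ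
down A i zero r = r
down A i (suc s) r = down A i s (_%_ r (seq A (i + suc s)) {{nz A (i + suc s)}})

-- The i-th digit of the greedy (a_i)-representation of n (0 above the top
-- position).  Since a_p ≥ p+1, positions > i+n carry digit 0, so starting the
-- greedy procedure at position i+n is the same as starting at the top position.
digit : RepSeq → ℕ → ℕ → ℕ
digit A i n = _/_ (down A i n n) (seq A i) {{nz A i}}

EndsInZeros : RepSeq → ℕ → ℕ → Set
EndsInZeros A m n = ∀ i → i < m → digit A i n ≡ 0

Zend : RepSeq → ℕ → Set
Zend A n = digit A 0 n ≡ 0

Volatile : RepSeq → ℕ → ℕ → Set
Volatile A m n = EndsInZeros A m (suc n)

NonVolatile : RepSeq → ℕ → Set
NonVolatile A n = digit A 0 (suc n) ≢ 0

twoVolatileᵇ : RepSeq → ℕ → Bool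
twoVolatileᵇ A n = (digit A 0 (suc n) ≡ᵇ 0) ∧ (digit A 1 (suc n) ≡ᵇ 0)

word : RepSeq → ℕ → ℕ
word A n = if twoVolatileᵇ A n then seq A 1 else digit A 0 n

Fergusonian : (ℕ → ℕ) → ℕ → Set
Fergusonian w k =
  ∀ i → suc i < k →
    (∀ n → w n ≡ i → w (suc n) ≡ suc i) ×
    (∀ n → w n ≡ suc i → Σ ℕ λ m → n ≡ suc m × w m ≡ i)

StronglyFergusonian : (ℕ → ℕ) → ℕ → Set
StronglyFergusonian w k = Fergusonian w k × (∀ n → ¬ (w n ≡ k × w (suc n) ≡ k))

Pred : Set₁
Pred = ℕ → Set

_⊆_ : Pred → Pred → Set
P ⊆ Q = ∀ x → P x → Q x

IsMex : ℕ → Pred → Set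
IsMex v P = ¬ P v × (∀ u → u < v → P u)

-- g is the Nim sequence of S: g n = mex { g (n - s) | s ∈ S, s ≤ n } for all n
-- (this recursion determines the Nim sequence uniquely)
IsNimSeq : Pred → (ℕ → ℕ) → Set
IsNimSeq S g = ∀ n → IsMex (g n) (λ v → Σ ℕ λ s → S s × s ≤ n × g (n ∸ s) ≡ v)

Tset : RepSeq → Pred
Tset A x = (Σ ℕ λ i → 2 ≤ i × x ≡ seq A i ∸ 1) ⊎ (1 ≤ x × x < seq A 1)

Nset : RepSeq → Pred
Nset A n = Zend A n × NonVolatile A n

Lset : RepSeq → Pred
Lset A n = ¬ Nset A n

Restrict : RepSeq → Pred → ℕ → Pred
Restrict A S i s = S s × s < seq A i

periodic : RepSeq → (ℕ → ℕ) → ℕ → ℕ → ℕ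
periodic A w i n = w (_%_ n (seq A i) {{nz A i}})

-- In the representation word w every letter j ≤ k is preceded by j − 1 (for j = k because
-- w has no factor kk), so w (n − t) = w n − t for t ≤ w n.  Moves of size 1, …, k − 1 ∈ T
-- therefore reach every value below w n, except 0 from a letter k; there n is 2-volatile, and
-- subtracting a_j − 1, with a_j the leading term of n + 1, lands on m = n + 1 − a_j, which
-- still ends in two zeros; as m − 1 carries k, m carries its last digit 0.  The value w n is
-- never reached: descending w n steps from n and from n − s would give two zeros of w, i.e.
-- two elements of N, at distance s ∈ S.  For the periodic word the same argument runs
-- modulo a_i, where the residue of n − s is that of n minus s, possibly plus a_i; the
-- wrapped case is excluded by the hypothesis a + a_i − S_i ⊆ L.
module Submission where

open import Defs
open import Data.Nat.Base
open import Data.Nat.Properties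
open import Data.Nat.DivMod
open import Data.Bool.Base using (true; false; if_then_else_; _∧_)
open import Data.Product using (Σ; ∃; _×_; _,_; proj₁; proj₂)
open import Data.Sum using (_⊎_; inj₁; inj₂)
open import Data.Empty using (⊥-elim)
open import Function.Base using (_∘_)
open import Relation.Nullary using (¬_; yes; no)
open import Relation.Binary.PropositionalEquality
open import Relation.Binary.Definitions using (tri<; tri≈; tri>)

OptionValue : Pred → (ℕ → ℕ) → ℕ → ℕ → Set
OptionValue S g n v = Σ ℕ λ s → S s × s ≤ n × g (n ∸ s) ≡ v

Descending : (ℕ → ℕ) → ℕ → Set
Descending g k = ∀ x j → suc j ≤ k → g x ≡ suc j → ∃ λ y → x ≡ suc y × g y ≡ j

ZerosSeparatedBy : Pred → (ℕ → ℕ) → Set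
ZerosSeparatedBy S g = ∀ n s → S s → s ≤ n → g n ≡ 0 → g (n ∸ s) ≢ 0

TopsReachZero : Pred → (ℕ → ℕ) → ℕ → Set
TopsReachZero S g k = ∀ n → g n ≡ k → OptionValue S g n 0

module _ {g : ℕ → ℕ} {k : ℕ} (desc : Descending g k) where

  descend : ∀ t x → g x ≤ k → t ≤ g x → t ≤ x × g (x ∸ t) ≡ g x ∸ t
  descend zero    x _    _    = z≤n , refl
  descend (suc t) x gx≤k t<gx = m∸n≢0⇒n<m x∸t≢0 , subst (λ z → g z ≡ g x ∸ suc t) y≡x∸1+t gy
    where
    gx∸t≡1+ : g x ∸ t ≡ suc (g x ∸ suc t)
    gx∸t≡1+ = +-∸-assoc 1 t<gx
    g[x∸t]≡1+ : g (x ∸ t) ≡ suc (g x ∸ suc t)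
    g[x∸t]≡1+ = trans (proj₂ (descend t x gx≤k (<⇒≤ t<gx))) gx∸t≡1+
    step : ∃ λ y → x ∸ t ≡ suc y × g y ≡ g x ∸ suc t
    step = desc (x ∸ t) (g x ∸ suc t) (subst (_≤ k) gx∸t≡1+ (≤-trans (m∸n≤m (g x) t) gx≤k)) g[x∸t]≡1+
    y : ℕ
    y = proj₁ step
    gy : g y ≡ g x ∸ suc t
    gy = proj₂ (proj₂ step)
    x∸t≢0 : x ∸ t ≢ 0
    x∸t≢0 x∸t≡0 = 0≢1+n (trans (sym x∸t≡0) (proj₁ (proj₂ step)))
    y≡x∸1+t : y ≡ x ∸ suc t
    y≡x∸1+t = trans (cong pred (sym (proj₁ (proj₂ step)))) (pred[m∸n]≡m∸[1+n] x t)

  descending⇒IsNimSeq : ∀ {S} → (∀ x → g x ≤ k) → (∀ s → 1 ≤ s → s < k → S s) →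
                        ZerosSeparatedBy S g → TopsReachZero S g k → IsNimSeq S g
  descending⇒IsNimSeq {S} g≤k small separated tops n = value-missed , smaller-values-hit
    where
    v : ℕ
    v = g n

    value-missed : ¬ OptionValue S g n v
    value-missed (s , Ss , s≤n , same) = separated (n ∸ v) s Ss s≤n∸v g[n∸v]≡0 g[n∸v∸s]≡0
      where
      open ≡-Reasoning
      from-n∸s : v ≤ n ∸ s × g (n ∸ s ∸ v) ≡ g (n ∸ s) ∸ v
      from-n∸s = descend v (n ∸ s) (subst (_≤ k) (sym same) (g≤k n)) (≤-reflexive (sym same))
      g[n∸v]≡0 : g (n ∸ v) ≡ 0
      g[n∸v]≡0 = trans (proj₂ (descend v n (g≤k n) ≤-refl)) (n∸n≡0 v)
      s≤n∸v : s ≤ n ∸ v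
      s≤n∸v = m+n≤o⇒m≤o∸n s (subst (_≤ n) (+-comm v s) (m≤o∸n⇒m+n≤o v s≤n (proj₁ from-n∸s)))
      g[n∸v∸s]≡0 : g (n ∸ v ∸ s) ≡ 0
      g[n∸v∸s]≡0 = begin
        g (n ∸ v ∸ s)   ≡⟨ cong g (∸-+-assoc n v s) ⟩
        g (n ∸ (v + s)) ≡⟨ cong (λ z → g (n ∸ z)) (+-comm v s) ⟩
        g (n ∸ (s + v)) ≡⟨ cong g (∸-+-assoc n s v) ⟨
        g (n ∸ s ∸ v)   ≡⟨ proj₂ from-n∸s ⟩
        g (n ∸ s) ∸ v   ≡⟨ cong (_∸ v) same ⟩
        v ∸ v           ≡⟨ n∸n≡0 v ⟩
        0               ∎

    jump : ∀ u → u < v → v ∸ u < k → OptionValue S g n u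
    jump u u<v v∸u<k = v ∸ u , small (v ∸ u) (m<n⇒0<n∸m u<v) v∸u<k , proj₁ d ,
                       trans (proj₂ d) (m∸[m∸n]≡n (<⇒≤ u<v))
      where
      d : v ∸ u ≤ n × g (n ∸ (v ∸ u)) ≡ v ∸ (v ∸ u)
      d = descend (v ∸ u) n (g≤k n) (m∸n≤m v u)

    smaller-values-hit : ∀ u → u < v → OptionValue S g n u
    smaller-values-hit zero 0<v with v <? k
    ... | yes v<k = jump zero 0<v v<k
    ... | no  v≮k = tops n (≤-antisym (g≤k n) (≮⇒≥ v≮k))
    smaller-values-hit (suc u) u<v =
      jump (suc u) u<v (<-≤-trans (∸-monoʳ-< z<s (<⇒≤ u<v)) (g≤k n))

module _ {q : ℕ} .{{_ : NonZero q}} where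

  [m∸n]%o≡m%o∸n : ∀ m n → n ≤ m % q → (m ∸ n) % q ≡ m % q ∸ n
  [m∸n]%o≡m%o∸n m n n≤m%q = begin
    (m ∸ n) % q                     ≡⟨ cong (λ z → (z ∸ n) % q) (m≡m%n+[m/n]*n m q) ⟩
    (m % q + (m / q) * q ∸ n) % q   ≡⟨ cong (_% q) (+-∸-comm ((m / q) * q) n≤m%q) ⟩
    (m % q ∸ n + (m / q) * q) % q   ≡⟨ [m+kn]%n≡m%n (m % q ∸ n) (m / q) q ⟩
    (m % q ∸ n) % q                 ≡⟨ m<n⇒m%n≡m (≤-<-trans (m∸n≤m (m % q) n) (m%n<n m q)) ⟩
    m % q ∸ n                       ∎
    where open ≡-Reasoning

  [[m∸n]%o+n]%o≡m%o : ∀ m n → n ≤ m → ((m ∸ n) % q + n) % q ≡ m % q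
  [[m∸n]%o+n]%o≡m%o m n n≤m = begin
    ((m ∸ n) % q + n) % q         ≡⟨ %-distribˡ-+ ((m ∸ n) % q) n q ⟩
    ((m ∸ n) % q % q + n % q) % q ≡⟨ cong (λ z → (z + n % q) % q) (m%n%n≡m%n (m ∸ n) q) ⟩
    ((m ∸ n) % q + n % q) % q     ≡⟨ %-distribˡ-+ (m ∸ n) n q ⟨
    (m ∸ n + n) % q               ≡⟨ cong (_% q) (m∸n+n≡m n≤m) ⟩
    m % q                         ∎
    where open ≡-Reasoning

  -- Since both summands are below q, the sum is m % q up to one wrap-around.
  [m∸n]%o+n≡m%o⊎m%o+o : ∀ m n → n ≤ m → n < q →
                        (m ∸ n) % q + n ≡ m % q ⊎ (m ∸ n) % q + n ≡ m % q + q
  [m∸n]%o+n≡m%o⊎m%o+o m n n≤m n<q with (m ∸ n) % q + n <? q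
  ... | yes c+n<q = inj₁ (trans (sym (m<n⇒m%n≡m c+n<q)) ([[m∸n]%o+n]%o≡m%o m n n≤m))
  ... | no c+n≮q  = inj₂ (begin
    c + n               ≡⟨ m∸n+n≡m q≤c+n ⟨
    c + n ∸ q + q       ≡⟨ cong (_+ q) (m<n⇒m%n≡m c+n∸q<q) ⟨
    (c + n ∸ q) % q + q ≡⟨ cong (_+ q) (m≤n⇒[n∸m]%m≡n%m q≤c+n) ⟩
    (c + n) % q + q     ≡⟨ cong (_+ q) ([[m∸n]%o+n]%o≡m%o m n n≤m) ⟩
    m % q + q           ∎)
    where
    open ≡-Reasoning
    c : ℕ
    c = (m ∸ n) % q
    q≤c+n : q ≤ c + n
    q≤c+n = ≮⇒≥ c+n≮q
    c+n∸q<q : c + n ∸ q < q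
    c+n∸q<q = subst (c + n ∸ q <_) (m+n∸n≡m q q) (∸-monoˡ-< (+-mono-< (m%n<n (m ∸ n) q) n<q) q≤c+n)

  Descending-% : ∀ {g k} → Descending g k → Descending (λ n → g (n % q)) k
  Descending-% {g} desc zero j 1+j≤k g0≡1+j with desc (0 % q) j 1+j≤k g0≡1+j
  ... | y , 0%q≡1+y , _ = ⊥-elim (0≢1+n (trans (sym (n≤0⇒n≡0 (m%n≤m 0 q))) 0%q≡1+y))
  Descending-% {g} desc (suc x) j 1+j≤k g≡1+j with desc (suc x % q) j 1+j≤k g≡1+j
  ... | y , [1+x]%q≡1+y , gy = x , refl , subst (λ z → g z ≡ j) (sym x%q≡y) gy
    where
    x%q≡y : x % q ≡ y
    x%q≡y = trans ([m∸n]%o≡m%o∸n (suc x) 1 (subst (1 ≤_) (sym [1+x]%q≡1+y) z<s))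
                  (cong pred [1+x]%q≡1+y)

both-zero? : ∀ p q → ((p ≡ᵇ 0) ∧ (q ≡ᵇ 0) ≡ true × p ≡ 0 × q ≡ 0) ⊎
                     ((p ≡ᵇ 0) ∧ (q ≡ᵇ 0) ≡ false × ¬ (p ≡ 0 × q ≡ 0))
both-zero? zero    zero    = inj₁ (refl , refl , refl)
both-zero? zero    (suc q) = inj₂ (refl , λ ())
both-zero? (suc p) q       = inj₂ (refl , λ ())

module Representation (A : RepSeq) where

  private
    a : ℕ → ℕ
    a = seq A

    k : ℕ
    k = seq A 1

    instance
      a-nonZero : ∀ {p} → NonZero (a p)
      a-nonZero {p} = nz A p

  seq-growth : ∀ p → p < a p
  seq-growth zero    = pos A 0
  seq-growth (suc p) = ≤-<-trans (seq-growth p) (incr A p)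

  seq-mono : ∀ {p q} → p ≤ q → a p ≤ a q
  seq-mono = mono′ ∘ ≤⇒≤′
    where
    mono′ : ∀ {p q} → p ≤′ q → a p ≤ a q
    mono′ ≤′-refl        = ≤-refl
    mono′ (≤′-step p≤′q) = ≤-trans (mono′ p≤′q) (<⇒≤ (incr A _))

  1<k : 1 < k
  1<k = subst (_< k) (seq₀ A) (incr A 0)

  bracket : ∀ x → 1 ≤ x → ∃ λ j → a j ≤ x × x < a (suc j)
  bracket (suc zero)    _ = 0 , ≤-reflexive (seq₀ A) , 1<k
  bracket (suc (suc x)) _ with bracket (suc x) (s≤s z≤n)
  ... | j , aj≤1+x , 1+x<aj+1 with suc (suc x) <? a (suc j)
  ...   | yes 2+x<aj+1 = j , m≤n⇒m≤1+n aj≤1+x , 2+x<aj+1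
  ...   | no  2+x≮aj+1 = suc j , ≮⇒≥ 2+x≮aj+1 , ≤-<-trans 1+x<aj+1 (incr A (suc j))

  down-above-top : ∀ i t s r → r < a (i + suc s) → down A i (t + s) r ≡ down A i s r
  down-above-top i zero    s r r<a = refl
  down-above-top i (suc t) s r r<a =
    trans (cong (down A i (t + s)) (m<n⇒m%n≡m r<a′)) (down-above-top i t s r r<a)
    where
    r<a′ : r < a (i + suc (t + s))
    r<a′ = <-≤-trans r<a (seq-mono (+-monoʳ-≤ i (s≤s (m≤n+m s t))))

  digit-from-above : ∀ i s x → x < a (i + suc s) → digit A i x ≡ down A i s x / a i
  digit-from-above i s x x<a = cong (_/ a i) (start-irrelevant (≤-total x s))
    where
    x<a′ : x < a (i + suc x)
    x<a′ = <-trans (m≤n+m (suc x) i) (seq-growth (i + suc x))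
    start-irrelevant : x ≤ s ⊎ s ≤ x → down A i x x ≡ down A i s x
    start-irrelevant (inj₁ x≤s) = sym (trans (cong (λ t → down A i t x) (sym (m∸n+n≡m x≤s)))
                                             (down-above-top i (s ∸ x) x x x<a′))
    start-irrelevant (inj₂ s≤x) = trans (cong (λ t → down A i t x) (sym (m∸n+n≡m s≤x)))
                                        (down-above-top i (x ∸ s) s x x<a)

  digit₀-small : ∀ x → x < k → digit A 0 x ≡ x
  digit₀-small x x<k = trans (digit-from-above 0 0 x x<k) (trans (/-congʳ (seq₀ A)) (n/1≡n x))

  digit₀<k : ∀ n → digit A 0 n < k
  digit₀<k n = subst (_< k) (sym (trans (/-congʳ (seq₀ A)) (n/1≡n (down A 0 n n))))
                     (down₀<k n n (<-trans (n<1+n n) (seq-growth (suc n))))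
    where
    down₀<k : ∀ s r → r < a (suc s) → down A 0 s r < k
    down₀<k zero    r r<k = r<k
    down₀<k (suc s) r _   = down₀<k s (r % a (suc s)) (m%n<n r (a (suc s)))

  digit₁-pos : ∀ x → k ≤ x → x < a 2 → 0 < digit A 1 x
  digit₁-pos x k≤x x<a₂ = subst (0 <_) (sym (digit-from-above 1 0 x x<a₂)) (m≥n⇒m/n>0 k≤x)

  digit-cong-% : ∀ i d x m → x < a (i + suc (suc d)) → m < a (i + suc (suc d)) →
                 x % a (i + suc d) ≡ m % a (i + suc d) → digit A i x ≡ digit A i m
  digit-cong-% i d x m x<a m<a x≡m = begin
    digit A i x                          ≡⟨ digit-from-above i (suc d) x x<a ⟩
    down A i d (x % a (i + suc d)) / a i ≡⟨ cong (λ r → down A i d r / a i) x≡m ⟩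
    down A i d (m % a (i + suc d)) / a i ≡⟨ digit-from-above i (suc d) m m<a ⟨
    digit A i m                          ∎
    where open ≡-Reasoning

  data WordView (n : ℕ) : Set where
    letter-k   : digit A 0 (suc n) ≡ 0 → digit A 1 (suc n) ≡ 0 → word A n ≡ k → WordView n
    last-digit : ¬ (digit A 0 (suc n) ≡ 0 × digit A 1 (suc n) ≡ 0) → word A n ≡ digit A 0 n → WordView n

  word-view : ∀ n → WordView n
  word-view n with both-zero? (digit A 0 (suc n)) (digit A 1 (suc n))
  ... | inj₁ (2-volatile , z₀ , z₁) = letter-k z₀ z₁ (cong (λ b → if b then k else digit A 0 n) 2-volatile)
  ... | inj₂ (not-2-volatile , ¬z)  = last-digit ¬z (cong (λ b → if b then k else digit A 0 n) not-2-volatile)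

  word≤k : ∀ n → word A n ≤ k
  word≤k n with word-view n
  ... | letter-k _ _ w≡k = ≤-reflexive w≡k
  ... | last-digit _ w≡d = subst (_≤ k) (sym w≡d) (<⇒≤ (digit₀<k n))

  word₀≡0 : word A 0 ≡ 0
  word₀≡0 with word-view 0
  ... | letter-k z₀ _ _ = ⊥-elim (0≢1+n (trans (sym z₀) (digit₀-small 1 1<k)))
  ... | last-digit _ w≡d = trans w≡d (digit₀-small 0 (<-trans z<s 1<k))

  periodic₀-IsNimSeq : ∀ S → (∀ s → S s → 1 ≤ s) → IsNimSeq (Restrict A S 0) (periodic A (word A) 0)
  periodic₀-IsNimSeq S S-pos n = no-option , λ u u<v → ⊥-elim (n≮0 (subst (u <_) v≡0 u<v))
    where
    v≡0 : word A (n % a 0) ≡ 0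
    v≡0 = trans (cong (word A) (trans (%-congʳ (seq₀ A)) (n%1≡0 n))) word₀≡0
    no-option : ¬ OptionValue (Restrict A S 0) (periodic A (word A) 0) n (word A (n % a 0))
    no-option (s , (Ss , s<a₀) , _) = <⇒≱ (subst (s <_) (seq₀ A) s<a₀) (S-pos s Ss)

  module _ (SF : StronglyFergusonian (word A) k) where

    private
      ferguson : Fergusonian (word A) k
      ferguson = proj₁ SF

      no-top-top : ∀ n → ¬ (word A n ≡ k × word A (suc n) ≡ k)
      no-top-top = proj₂ SF

    zero⇒Nset : ∀ n → word A n ≡ 0 → Nset A n
    zero⇒Nset n w≡0 = zend (word-view n) , non-volatile (word-view (suc n))
      where
      w′≡1 : word A (suc n) ≡ 1
      w′≡1 = proj₁ (ferguson 0 1<k) n w≡0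
      zend : WordView n → digit A 0 n ≡ 0
      zend (letter-k _ _ w≡k) = ⊥-elim (<⇒≢ (<-trans z<s 1<k) (trans (sym w≡0) w≡k))
      zend (last-digit _ w≡d) = trans (sym w≡d) w≡0
      non-volatile : WordView (suc n) → digit A 0 (suc n) ≢ 0
      non-volatile (letter-k _ _ w≡k) _   = <⇒≢ 1<k (trans (sym w′≡1) w≡k)
      non-volatile (last-digit _ w≡d) d≡0 = 0≢1+n (trans (sym d≡0) (trans (sym w≡d) w′≡1))

    word-descending : Descending (word A) k
    word-descending x j 1+j≤k w≡1+j with suc j <? k
    ... | yes 1+j<k = proj₂ (ferguson j 1+j<k) x w≡1+j
    ... | no  1+j≮k = preceded x w≡1+j
      where
      1+j≡k : suc j ≡ k
      1+j≡k = ≤-antisym 1+j≤k (≮⇒≥ 1+j≮k)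
      preceded : ∀ x → word A x ≡ suc j → ∃ λ y → x ≡ suc y × word A y ≡ j
      preceded zero    w≡1+j = ⊥-elim (0≢1+n (trans (sym word₀≡0) w≡1+j))
      preceded (suc y) w≡1+j with <-cmp (word A y) j
      ... | tri< wy<j _ _ = ⊥-elim (<⇒≢ wy<j (suc-injective
                              (trans (sym (proj₁ (ferguson (word A y) (<-≤-trans (s≤s wy<j) 1+j≤k)) y refl)) w≡1+j)))
      ... | tri≈ _ wy≡j _ = y , refl , wy≡j
      ... | tri> _ _ wy>j = ⊥-elim (no-top-top y (≤-antisym (word≤k y) (subst (_≤ word A y) 1+j≡k wy>j) ,
                                                trans w≡1+j 1+j≡k))

    -- A 2-volatile position carries the letter k, so the next one cannot.
    digits₀₁-zero⇒word-zero : ∀ m → digit A 0 m ≡ 0 → digit A 1 m ≡ 0 → word A m ≡ 0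
    digits₀₁-zero⇒word-zero zero    _  _  = word₀≡0
    digits₀₁-zero⇒word-zero (suc m) z₀ z₁ with word-view (suc m) | word-view m
    ... | last-digit _ w≡d | _                 = trans w≡d z₀
    ... | letter-k _ _ w≡k | letter-k _ _ w′≡k = ⊥-elim (no-top-top m (w′≡k , w≡k))
    ... | letter-k _ _ _   | last-digit ¬z _   = ⊥-elim (¬z (z₀ , z₁))

    -- If n + 1 ends in two zeros, subtracting its leading term a_j (j ≥ 2) keeps them.
    word-tops-reach-zero : TopsReachZero (Tset A) (word A) k
    word-tops-reach-zero n w≡k with word-view n | bracket (suc n) (s≤s z≤n)
    ... | last-digit _ w≡d | _ = ⊥-elim (<⇒≢ (digit₀<k n) (trans (sym w≡d) w≡k))
    ... | letter-k z₀ _ _  | zero , _ , 1+n<k =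
      ⊥-elim (0≢1+n (trans (sym z₀) (digit₀-small (suc n) 1+n<k)))
    ... | letter-k _ z₁ _  | suc zero , k≤1+n , 1+n<a₂ =
      ⊥-elim (<⇒≢ (digit₁-pos (suc n) k≤1+n 1+n<a₂) (sym z₁))
    ... | letter-k z₀ z₁ _ | suc (suc d) , aj≤1+n , 1+n<aj+1 =
      a j ∸ 1 , inj₁ (j , s≤s (s≤s z≤n) , refl) , ∸-monoˡ-≤ 1 aj≤1+n ,
      subst (λ m → word A m ≡ 0) (sym n∸[aj∸1]≡m) (digits₀₁-zero⇒word-zero m m₀ m₁)
      where
      j m : ℕ
      j = suc (suc d)
      m = suc n ∸ a j
      n∸[aj∸1]≡m : n ∸ (a j ∸ 1) ≡ m
      n∸[aj∸1]≡m = cong (suc n ∸_) (m+[n∸m]≡n (pos A j))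
      m<aj+1 : m < a (suc j)
      m<aj+1 = ≤-<-trans (m∸n≤m (suc n) (a j)) 1+n<aj+1
      same-residue : suc n % a j ≡ m % a j
      same-residue = sym (m≤n⇒[n∸m]%m≡n%m aj≤1+n)
      m₀ : digit A 0 m ≡ 0
      m₀ = trans (sym (digit-cong-% 0 (suc d) (suc n) m 1+n<aj+1 m<aj+1 same-residue)) z₀
      m₁ : digit A 1 m ≡ 0
      m₁ = trans (sym (digit-cong-% 1 d (suc n) m 1+n<aj+1 m<aj+1 same-residue)) z₁

    module _ (S : Pred) (T⊆S : Tset A ⊆ S) (N+S∩N≡∅ : ∀ x s → Nset A x → S s → ¬ Nset A (x + s)) where

      word-IsNimSeq : IsNimSeq S (word A)
      word-IsNimSeq = descending⇒IsNimSeq word-descending word≤k small separated tops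
        where
        small : ∀ s → 1 ≤ s → s < k → S s
        small s 1≤s s<k = T⊆S s (inj₂ (1≤s , s<k))
        separated : ZerosSeparatedBy S (word A)
        separated n s Ss s≤n wn≡0 wn∸s≡0 = N+S∩N≡∅ (n ∸ s) s (zero⇒Nset (n ∸ s) wn∸s≡0) Ss
                                             (subst (Nset A) (sym (m∸n+n≡m s≤n)) (zero⇒Nset n wn≡0))
        tops : TopsReachZero S (word A) k
        tops n w≡k with word-tops-reach-zero n w≡k
        ... | s , Ts , s≤n , w≡0 = s , T⊆S s Ts , s≤n , w≡0

      periodic-IsNimSeq : ∀ i →
        (∀ b → Nset A b → b < a (suc i) → ∀ s → Restrict A S (suc i) s → Lset A (b + a (suc i) ∸ s)) →
        IsNimSeq (Restrict A S (suc i)) (periodic A (word A) (suc i))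
      periodic-IsNimSeq i wrap-in-L =
        descending⇒IsNimSeq (Descending-% word-descending) (λ x → word≤k (x % q)) small separated tops
        where
        q : ℕ
        q = a (suc i)
        small : ∀ s → 1 ≤ s → s < k → Restrict A S (suc i) s
        small s 1≤s s<k = T⊆S s (inj₂ (1≤s , s<k)) , <-≤-trans s<k (seq-mono (s≤s z≤n))
        separated : ZerosSeparatedBy (Restrict A S (suc i)) (periodic A (word A) (suc i))
        separated n s (Ss , s<q) s≤n wn≡0 wn∸s≡0 with [m∸n]%o+n≡m%o⊎m%o+o {q = q} n s s≤n s<q
        ... | inj₁ no-wrap = N+S∩N≡∅ ((n ∸ s) % q) s (zero⇒Nset ((n ∸ s) % q) wn∸s≡0) Ss
                               (subst (Nset A) (sym no-wrap) (zero⇒Nset (n % q) wn≡0))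
        ... | inj₂ wrap    = wrap-in-L (n % q) (zero⇒Nset (n % q) wn≡0) (m%n<n n q) s (Ss , s<q)
                               (subst (Nset A) (trans (sym (m+n∸n≡m _ s)) (cong (_∸ s) wrap))
                                      (zero⇒Nset ((n ∸ s) % q) wn∸s≡0))
        tops : TopsReachZero (Restrict A S (suc i)) (periodic A (word A) (suc i)) k
        tops n w≡k with word-tops-reach-zero (n % q) w≡k
        ... | s , Ts , s≤n%q , w≡0 = s , (T⊆S s Ts , ≤-<-trans s≤n%q (m%n<n n q)) ,
                                    ≤-trans s≤n%q (m%n≤m n q) ,
                                    trans (cong (word A) ([m∸n]%o≡m%o∸n n s s≤n%q)) w≡0

theorem4p11 : (A : RepSeq) → StronglyFergusonian (word A) (seq A 1) →
    (I : Pred) → (∀ x → I x → 1 ≤ x) → Tset A ⊆ I →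
    (∀ x y → Nset A x → I y → ¬ Nset A (x + y)) →
    ((S : Pred) → Tset A ⊆ S → S ⊆ I → IsNimSeq S (word A)) ×
    ((S : Pred) → Tset A ⊆ S → S ⊆ I → (i : ℕ) →
      (∀ a → Nset A a → a < seq A i → ∀ s → Restrict A S i s → Lset A (a + seq A i ∸ s)) →
      IsNimSeq (Restrict A S i) (periodic A (word A) i))
-- T ⊆ I is implied by the hypotheses T ⊆ S ⊆ I of both parts.
theorem4p11 A SF I I-pos _ N+I∩N≡∅ =
  (λ S T⊆S S⊆I → word-IsNimSeq SF S T⊆S (separated S⊆I)) ,
  λ where
    S _   S⊆I zero    _ → periodic₀-IsNimSeq S (λ s Ss → I-pos s (S⊆I s Ss))
    S T⊆S S⊆I (suc i)   → periodic-IsNimSeq SF S T⊆S (separated S⊆I) i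
  where
  open Representation A
  separated : ∀ {S} → S ⊆ I → ∀ x s → Nset A x → S s → ¬ Nset A (x + s)
  separated S⊆I x s Nx Ss = N+I∩N≡∅ x s Nx (S⊆I s Ss)
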